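{- Let $\Sigma_4=\{0,1,2,3\}$, let $h$ be the morphism $h(0)=0310201023$, $h(1)=0310230102$, $h(2)=0201031023$, $h(3)=0203010201$, and $g:\Sigma_4^*\to\{0,1\}^*$ the morphism $g(0)=010011$, $g(1)=010110$, $g(2)=011001$, $g(3)=011010$. Let $h'$ be the substitution $h'(0)=\{h(0)\}$, $h'(1)=\{h(1),\,0310230201\}$, $h'(2)=\{h(2)\}$, $h'(3)=\{h(3)\}$. Let $m$ be a positive integer and $w=h^m(0)$. Then $g(h'(w))$ is a set of $2^{n/300}$ binary words, each of length $n=60\cdot 10^m$, and each of these words is cubefree and contains no square $xx$ with $|x|\ge 4$.
   Context: For a word $w=a_1\cdots a_k$, $h'(w)$ is the set of all words $u_1u_2\cdots u_k$ with $u_i\in h'(a_i)$, and $g(h'(w))=\{g(u):u\in h'(w)\}$. A square is a nonempty word $xx$, a cube a nonempty word $xxx$. -}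

module Defs where

open import Data.Nat using (ℕ; _≤_)
open import Data.List using (List; []; _∷_; _++_; concatMap; length)
open import Data.List.Membership.Propositional using (_∈_)
open import Data.Product using (∃; ∃-syntax; _×_)
open import Relation.Binary.PropositionalEquality using (_≡_)
open import Relation.Nullary using (¬_)

data Σ₄ : Set where
  a0 a1 a2 a3 : Σ₄

data Bit : Set where
  b0 b1 : Bit

h₁ : Σ₄ → List Σ₄
h₁ a0 = a0 ∷ a3 ∷ a1 ∷ a0 ∷ a2 ∷ a0 ∷ a1 ∷ a0 ∷ a2 ∷ a3 ∷ []
h₁ a1 = a0 ∷ a3 ∷ a1 ∷ a0 ∷ a2 ∷ a3 ∷ a0 ∷ a1 ∷ a0 ∷ a2 ∷ []
h₁ a2 = a0 ∷ a2 ∷ a0 ∷ a1 ∷ a0 ∷ a3 ∷ a1 ∷ a0 ∷ a2 ∷ a3 ∷ []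
h₁ a3 = a0 ∷ a2 ∷ a0 ∷ a3 ∷ a0 ∷ a1 ∷ a0 ∷ a2 ∷ a0 ∷ a1 ∷ []

h : List Σ₄ → List Σ₄
h = concatMap h₁

h^ : ℕ → List Σ₄ → List Σ₄
h^ ℕ.zero w = w
h^ (ℕ.suc m) w = h (h^ m w)

g₁ : Σ₄ → List Bit
g₁ a0 = b0 ∷ b1 ∷ b0 ∷ b0 ∷ b1 ∷ b1 ∷ []
g₁ a1 = b0 ∷ b1 ∷ b0 ∷ b1 ∷ b1 ∷ b0 ∷ []
g₁ a2 = b0 ∷ b1 ∷ b1 ∷ b0 ∷ b0 ∷ b1 ∷ []
g₁ a3 = b0 ∷ b1 ∷ b1 ∷ b0 ∷ b1 ∷ b0 ∷ []

g : List Σ₄ → List Bit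
g = concatMap g₁

h'₁ : Σ₄ → List (List Σ₄)
h'₁ a0 = h₁ a0 ∷ []
h'₁ a1 = h₁ a1 ∷ (a0 ∷ a3 ∷ a1 ∷ a0 ∷ a2 ∷ a3 ∷ a0 ∷ a2 ∷ a0 ∷ a1 ∷ []) ∷ []
h'₁ a2 = h₁ a2 ∷ []
h'₁ a3 = h₁ a3 ∷ []

data _∈h'_ : List Σ₄ → List Σ₄ → Set where
  []  : [] ∈h' []
  _∷_ : ∀ {a w u v} → u ∈ h'₁ a → v ∈h' w → (u ++ v) ∈h' (a ∷ w)

_∈gh'_ : List Bit → List Σ₄ → Set
u ∈gh' w = ∃[ v ] (v ∈h' w × g v ≡ u)

Cubefree : {A : Set} → List A → Set
Cubefree {A} w = ¬ (∃[ p ] ∃[ x ] ∃[ s ] (¬ (x ≡ []) × w ≡ p ++ x ++ x ++ x ++ s))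

NoLongSquare : {A : Set} → List A → Set
NoLongSquare {A} w = ¬ (∃[ p ] ∃[ x ] ∃[ s ] (4 ≤ length x × w ≡ p ++ x ++ x ++ s))

-- Both h (10-uniform) and ψ a = g(h′(a)) (60-uniform) are checked to be synchronizing: in any of
-- their images, a window of 12 (resp. 83) symbols determines its position modulo the block length,
-- so a square of period at least that long has a period that is a multiple of the block length.
-- Since images of distinct letters differ on a prefix and on a suffix that together cover a whole
-- block, such a square desubstitutes to a square of the preimage. Shorter squares and cubes only
-- involve the images of 4-letter factors, of which the fixed point of h has finitely many; these are
-- checked exhaustively. Induction on m makes h^m(0) squarefree, and then every word of
-- g(h′(h^m(0))) avoids cubes and squares of period at least 4. Each of the 2 · 10^(m-1) letters 1
-- of h^m(0) offers two images, and g ∘ h′ is injective on choices, so there are 4^(10^(m-1)) words.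

module Submission where

open import Defs
open import Data.Bool using (Bool; true; false; T; not; _∧_; _∨_; if_then_else_)
open import Data.Bool.ListAction using (all)
open import Data.Bool.Properties using (T-∧; T-≡)
open import Data.Empty using (⊥; ⊥-elim)
open import Data.List using (List; []; _∷_; _++_; concat; concatMap; map; length; take; drop; foldr; cartesianProductWith)
open import Data.List.Properties
  using (length-++; drop-drop; drop-[]; length-map; length-drop; ∷-injective; ≡-dec; map-++; map-cong; concat-++)
open import Data.List.Membership.Propositional using (_∈_)
open import Data.List.Membership.Propositional.Properties
  using (∈-map⁺; ∈-map⁻; ∈-cartesianProductWith⁺; ∈-cartesianProductWith⁻)
open import Data.List.Relation.Unary.All using (All; []; _∷_; lookup; zipWith; tabulate)
open import Data.List.Relation.Unary.All.Properties using (all⁺) renaming (map⁺ to All-map⁺)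
open import Data.List.Relation.Unary.AllPairs using ([]; _∷_)
open import Data.List.Relation.Unary.Any using (here; there)
open import Data.List.Relation.Unary.Unique.Propositional using (Unique)
open import Data.List.Relation.Unary.Unique.Propositional.Properties
  using () renaming (cartesianProductWith⁺ to Unique-cartesianProductWith⁺)
open import Data.Maybe using (Maybe; just; nothing; fromMaybe)
open import Data.Nat using (ℕ; zero; suc; _+_; _*_; _^_; _∸_; _≤_; _<_; z≤n; s≤s; _≤ᵇ_; _≡ᵇ_; NonZero)
open import Data.Nat.DivMod using (_/_; _%_; m%n<n; m≡m%n+[m/n]*n; m*n/n≡m)
open import Data.Nat.ListAction using (product)
open import Data.Nat.ListAction.Properties using (product-++)
open import Data.Nat.Properties
open import Data.Nat.Tactic.RingSolver using (solve-∀)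
open import Data.Product using (∃; ∃-syntax; ∃₂; _×_; _,_; proj₁; proj₂)
open import Data.Sum using (inj₁; inj₂)
open import Function using (_∘_; case_of_)
open import Function.Bundles using (_⇔_; mk⇔; Equivalence)
open import Relation.Binary.Definitions using (DecidableEquality)
open import Relation.Binary.PropositionalEquality
  using (_≡_; refl; sym; trans; cong; cong₂; subst; subst₂; module ≡-Reasoning)
open import Relation.Nullary using (¬_; yes; no; map′)
open import Relation.Nullary.Decidable using (T?; isYes; toWitness)

module _ {X : Set} where

  infixl 10 _‼_

  _‼_ : List X → ℕ → Maybe X
  []       ‼ _     = nothing
  (x ∷ xs) ‼ zero  = just x
  (x ∷ xs) ‼ suc n = xs ‼ n

  ‼-drop : ∀ a (u : List X) t → drop a u ‼ t ≡ u ‼ (a + t)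
  ‼-drop zero    u       t = refl
  ‼-drop (suc a) []      t = refl
  ‼-drop (suc a) (x ∷ u) t = ‼-drop a u t

  ‼-take : ∀ n (u : List X) {t} → t < n → take n u ‼ t ≡ u ‼ t
  ‼-take (suc n) []      _               = refl
  ‼-take (suc n) (x ∷ u) {zero}  _       = refl
  ‼-take (suc n) (x ∷ u) {suc t} (s≤s t<n) = ‼-take n u t<n

  ‼-take-≥ : ∀ n (u : List X) {t} → n ≤ t → take n u ‼ t ≡ nothing
  ‼-take-≥ zero    u       _               = refl
  ‼-take-≥ (suc n) []      _               = refl
  ‼-take-≥ (suc n) (x ∷ u) {suc t} (s≤s n≤t) = ‼-take-≥ n u n≤t

  ‼-++ˡ : ∀ (xs ys : List X) {t} → t < length xs → (xs ++ ys) ‼ t ≡ xs ‼ t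
  ‼-++ˡ (x ∷ xs) ys {zero}  _         = refl
  ‼-++ˡ (x ∷ xs) ys {suc t} (s≤s t<n) = ‼-++ˡ xs ys t<n

  ‼-++ʳ : ∀ (xs ys : List X) t → (xs ++ ys) ‼ (length xs + t) ≡ ys ‼ t
  ‼-++ʳ []       ys t = refl
  ‼-++ʳ (x ∷ xs) ys t = ‼-++ʳ xs ys t

  ‼-defined : ∀ (u : List X) {t} → t < length u → ∃[ x ] u ‼ t ≡ just x
  ‼-defined (x ∷ u) {zero}  _         = x , refl
  ‼-defined (x ∷ u) {suc t} (s≤s t<n) = ‼-defined u t<n

  ‼-undefined : ∀ (u : List X) {t} → length u ≤ t → u ‼ t ≡ nothing
  ‼-undefined []      _                 = refl
  ‼-undefined (x ∷ u) {suc t} (s≤s n≤t) = ‼-undefined u n≤t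

  ‼-defined⇒≤length : ∀ n (u : List X) → (∀ t → t < n → ∃[ x ] u ‼ t ≡ just x) → n ≤ length u
  ‼-defined⇒≤length n u defined with n ≤? length u
  ... | yes n≤ = n≤
  ... | no n≰ with defined (length u) (≰⇒> n≰)
  ...   | x , eq with trans (sym eq) (‼-undefined u ≤-refl)
  ...     | ()

  ‼-ext : ∀ (xs ys : List X) → (∀ t → xs ‼ t ≡ ys ‼ t) → xs ≡ ys
  ‼-ext []       []       _  = refl
  ‼-ext []       (y ∷ ys) eq with eq 0
  ... | ()
  ‼-ext (x ∷ xs) []       eq with eq 0
  ... | ()
  ‼-ext (x ∷ xs) (y ∷ ys) eq with eq 0
  ... | refl = cong (x ∷_) (‼-ext xs ys (eq ∘ suc))

  take-‼ : ∀ n (xs ys : List X) → (∀ t → t < n → xs ‼ t ≡ ys ‼ t) → take n xs ≡ take n ys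
  take-‼ n xs ys eq = ‼-ext _ _ λ t → case t <? n of λ where
    (yes t<n) → trans (‼-take n xs t<n) (trans (eq t t<n) (sym (‼-take n ys t<n)))
    (no t≮n)  → trans (‼-take-≥ n xs (≮⇒≥ t≮n)) (sym (‼-take-≥ n ys (≮⇒≥ t≮n)))

  -- The factor of u of length n + p starting at a has period p.
  Periodic : List X → (a p n : ℕ) → Set
  Periodic u a p n = ∀ y → a ≤ y → y < a + n → u ‼ y ≡ u ‼ (y + p)

  Periodic-++ : ∀ (pre w : List X) p n → (∀ t → t < n → w ‼ t ≡ w ‼ (t + p)) →
                Periodic (pre ++ w) (length pre) p n
  Periodic-++ pre w p n periodic y pre≤y y<pre+n = begin
    (pre ++ w) ‼ y                      ≡⟨ cong ((pre ++ w) ‼_) (sym y≡) ⟩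
    (pre ++ w) ‼ (length pre + t)       ≡⟨ ‼-++ʳ pre w t ⟩
    w ‼ t                               ≡⟨ periodic t (+-cancelˡ-< (length pre) t n (subst (_< length pre + n) (sym y≡) y<pre+n)) ⟩
    w ‼ (t + p)                         ≡⟨ sym (‼-++ʳ pre w (t + p)) ⟩
    (pre ++ w) ‼ (length pre + (t + p)) ≡⟨ cong ((pre ++ w) ‼_) (trans (sym (+-assoc (length pre) t p)) (cong (_+ p) y≡)) ⟩
    (pre ++ w) ‼ (y + p)                ∎
    where
    open ≡-Reasoning
    t = y ∸ length pre
    y≡ : length pre + t ≡ y
    y≡ = m+[n∸m]≡n pre≤y

  square-periodic : ∀ (x s : List X) t → t < length x → (x ++ x ++ s) ‼ t ≡ (x ++ x ++ s) ‼ (t + length x)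
  square-periodic x s t t<x = begin
    (x ++ x ++ s) ‼ t                ≡⟨ ‼-++ˡ x _ t<x ⟩
    x ‼ t                            ≡⟨ sym (‼-++ˡ x s t<x) ⟩
    (x ++ s) ‼ t                     ≡⟨ sym (‼-++ʳ x (x ++ s) t) ⟩
    (x ++ x ++ s) ‼ (length x + t)   ≡⟨ cong ((x ++ x ++ s) ‼_) (+-comm (length x) t) ⟩
    (x ++ x ++ s) ‼ (t + length x)   ∎
    where open ≡-Reasoning

  cube-periodic : ∀ (x s : List X) t → t < length x + length x →
                  (x ++ x ++ x ++ s) ‼ t ≡ (x ++ x ++ x ++ s) ‼ (t + length x)
  cube-periodic x s t t<2x with t <? length x
  ... | yes t<x = square-periodic x (x ++ s) t t<x
  ... | no t≮x = begin
    (x ++ xxs) ‼ t                       ≡⟨ cong ((x ++ xxs) ‼_) (sym t≡) ⟩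
    (x ++ xxs) ‼ (length x + t′)         ≡⟨ ‼-++ʳ x xxs t′ ⟩
    xxs ‼ t′                             ≡⟨ square-periodic x s t′ (+-cancelˡ-< (length x) t′ (length x) (subst (_< length x + length x) (sym t≡) t<2x)) ⟩
    xxs ‼ (t′ + length x)                ≡⟨ sym (‼-++ʳ x xxs (t′ + length x)) ⟩
    (x ++ xxs) ‼ (length x + (t′ + length x)) ≡⟨ cong ((x ++ xxs) ‼_) (trans (sym (+-assoc (length x) t′ (length x))) (cong (_+ length x) t≡)) ⟩
    (x ++ xxs) ‼ (t + length x)          ∎
    where
    open ≡-Reasoning
    xxs = x ++ x ++ s
    t′ = t ∸ length x
    t≡ : length x + t′ ≡ t
    t≡ = m+[n∸m]≡n (≮⇒≥ t≮x)

  length-square : ∀ (pre x s : List X) → length pre + (length x + length x) ≤ length (pre ++ x ++ x ++ s)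
  length-square pre x s rewrite length-++ pre {x ++ x ++ s} | length-++ x {x ++ s} | length-++ x {s} =
    +-monoʳ-≤ (length pre) (+-monoʳ-≤ (length x) (m≤m+n (length x) (length s)))

  length-cube : ∀ (pre x s : List X) → length pre + (length x + length x + length x) ≤ length (pre ++ x ++ x ++ x ++ s)
  length-cube pre x s
    rewrite length-++ pre {x ++ x ++ x ++ s} | length-++ x {x ++ x ++ s} | length-++ x {x ++ s} | length-++ x {s}
          | +-assoc (length x) (length x) (length x) =
    +-monoʳ-≤ (length pre) (+-monoʳ-≤ (length x) (+-monoʳ-≤ (length x) (m≤m+n (length x) (length s))))

  Periodic-shorten : ∀ u {a p n m} → m ≤ n → Periodic u a p n → Periodic u a p m
  Periodic-shorten u m≤n periodic y a≤y y<a+m = periodic y a≤y (≤-trans y<a+m (+-monoʳ-≤ _ m≤n))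

SquareFree : {X : Set} → List X → Set
SquareFree W = ∀ b q → 1 ≤ q → b + (q + q) ≤ length W → ¬ Periodic W b q q

WindowsIn : {X : Set} → ℕ → List (List X) → List X → Set
WindowsIn M F W = ∀ j → take M (drop j W) ∈ F

NoLongSquare-if-aperiodic : ∀ {X : Set} {u : List X} →
  (∀ a p → 4 ≤ p → a + (p + p) ≤ length u → ¬ Periodic u a p p) → NoLongSquare u
NoLongSquare-if-aperiodic aperiodic (pre , x , s , 4≤x , refl) =
  aperiodic (length pre) (length x) 4≤x (length-square pre x s)
    (Periodic-++ pre (x ++ x ++ s) (length x) (length x) (square-periodic x s))

Cubefree-if-aperiodic : ∀ {X : Set} {u : List X} →
  (∀ a p → 1 ≤ p → a + (p + p + p) ≤ length u → ¬ Periodic u a p (p + p)) → Cubefree u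
Cubefree-if-aperiodic aperiodic (pre , []    , s , x≢[] , _)    = x≢[] refl
Cubefree-if-aperiodic aperiodic (pre , x@(_ ∷ _) , s , _ , refl) =
  aperiodic (length pre) (length x) (s≤s z≤n) (length-cube pre x s)
    (Periodic-++ pre (x ++ x ++ x ++ s) (length x) (length x + length x) (cube-periodic x s))

T-⇒ : ∀ {x y} → T (not x ∨ y) → T x → T y
T-⇒ {true} y _ = y

T-¬∧ : ∀ {x y} → T (not (x ∧ y)) → T x → T y → ⊥
T-¬∧ {true} {true} () _ _

T-all : ∀ {X : Set} (p : X → Bool) {xs x} → T (all p xs) → x ∈ xs → T (p x)
T-all p {xs} ok x∈xs = lookup (all⁺ p xs ok) x∈xs

module _ {B : Set} where

  allShiftsᵇ : (ℕ → List B → Bool) → ℕ → ℕ → List B → Bool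
  allShiftsᵇ f p zero    s = true
  allShiftsᵇ f p (suc n) s = f p s ∧ allShiftsᵇ f (suc p) n (drop 1 s)

  allShiftsᵇ-sound : ∀ f p n s {i} → T (allShiftsᵇ f p n s) → i < n → T (f (p + i) (drop i s))
  allShiftsᵇ-sound f p (suc n) s {zero} ok _ =
    subst (λ q → T (f q s)) (sym (+-identityʳ p)) (proj₁ (Equivalence.to T-∧ ok))
  allShiftsᵇ-sound f p (suc n) s {suc i} ok (s≤s i<n) =
    subst₂ (λ q t → T (f q t)) (sym (+-suc p i)) (drop-drop 1 i s)
      (allShiftsᵇ-sound f (suc p) n (drop 1 s) (proj₂ (Equivalence.to T-∧ ok)) i<n)

++-injective-length : ∀ {X : Set} (xs ys : List X) {zs ws} → length xs ≡ length ys → xs ++ zs ≡ ys ++ ws → xs ≡ ys × zs ≡ ws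
++-injective-length []       []       _   eq = refl , eq
++-injective-length (x ∷ xs) (y ∷ ys) len eq with ∷-injective eq
... | refl , eq′ with ++-injective-length xs ys (suc-injective len) eq′
...   | refl , rest = refl , rest

length-cartesianProductWith : ∀ {X Y Z : Set} (f : X → Y → Z) xs ys →
                              length (cartesianProductWith f xs ys) ≡ length xs * length ys
length-cartesianProductWith f []       ys = refl
length-cartesianProductWith f (x ∷ xs) ys = begin
  length (map (f x) ys ++ cartesianProductWith f xs ys)        ≡⟨ length-++ (map (f x) ys) ⟩
  length (map (f x) ys) + length (cartesianProductWith f xs ys) ≡⟨ cong₂ _+_ (length-map (f x) ys) (length-cartesianProductWith f xs ys) ⟩
  length ys + length xs * length ys                            ∎
  where open ≡-Reasoning

Unique-map-on : ∀ {X Y : Set} (f : X → Y) (P : X → Set) {xs} → All P xs →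
                (∀ {x y} → P x → P y → f x ≡ f y → x ≡ y) → Unique xs → Unique (map f xs)
Unique-map-on f P []         _   []             = []
Unique-map-on f P (px ∷ pxs) inj (x∉ ∷ unique) =
  All-map⁺ (zipWith (λ (x≢y , py) fx≡fy → x≢y (inj px py fx≡fy)) (x∉ , pxs)) ∷ Unique-map-on f P pxs inj unique

module PrefixEquality {B : Set} (_==_ : B → B → Bool) (==-refl : ∀ x → T (x == x)) where

  prefixEqᵇ : ℕ → List B → List B → Bool
  prefixEqᵇ zero    _        _        = true
  prefixEqᵇ (suc n) (x ∷ xs) (y ∷ ys) = (x == y) ∧ prefixEqᵇ n xs ys
  prefixEqᵇ (suc n) _        _        = false

  prefixEqᵇ-complete : ∀ n xs ys → n ≤ length xs → (∀ t → t < n → xs ‼ t ≡ ys ‼ t) → T (prefixEqᵇ n xs ys)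
  prefixEqᵇ-complete zero    xs       ys       _         _  = _
  prefixEqᵇ-complete (suc n) (x ∷ xs) []       _         eq with eq 0 (s≤s z≤n)
  ... | ()
  prefixEqᵇ-complete (suc n) (x ∷ xs) (y ∷ ys) (s≤s n≤) eq with eq 0 (s≤s z≤n)
  ... | refl = Equivalence.from T-∧ (==-refl x , prefixEqᵇ-complete n xs ys n≤ (λ t t<n → eq (suc t) (s≤s t<n)))

block-shift : ∀ k i o q → k * i + o + k * q ≡ k * (i + q) + o
block-shift = solve-∀

block-start : ∀ k j q → k * (j + q + q) ≡ k * j + (k * q + k * q)
block-start = solve-∀

+-comm-last : ∀ a b c → a + b + c ≡ a + c + b
+-comm-last = solve-∀

module Substitution {A B : Set} (φ : A → List (List B)) where

  data Image : List (List B) → List A → Set where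
    []  : Image [] []
    _∷_ : ∀ {X a Bs W} → X ∈ φ a → Image Bs W → Image (X ∷ Bs) (a ∷ W)

  images : List A → List (List (List B))
  images []      = [] ∷ []
  images (a ∷ W) = cartesianProductWith _∷_ (φ a) (images W)

  Image⇒∈images : ∀ {Bs W} → Image Bs W → Bs ∈ images W
  Image⇒∈images []          = here refl
  Image⇒∈images (X∈ ∷ image) = ∈-cartesianProductWith⁺ _∷_ X∈ (Image⇒∈images image)

  ∈images⇒Image : ∀ W {Bs} → Bs ∈ images W → Image Bs W
  ∈images⇒Image []      (here refl) = []
  ∈images⇒Image (a ∷ W) Bs∈ with ∈-cartesianProductWith⁻ _∷_ (φ a) (images W) Bs∈
  ... | X , Bs , X∈ , Bs∈′ , refl = X∈ ∷ ∈images⇒Image W Bs∈′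

  images-unique : (∀ a → Unique (φ a)) → ∀ W → Unique (images W)
  images-unique unique []      = [] ∷ []
  images-unique unique (a ∷ W) = Unique-cartesianProductWith⁺ _∷_ ∷-injective (unique a) (images-unique unique W)

  length-images : ∀ W → length (images W) ≡ product (map (length ∘ φ) W)
  length-images []      = refl
  length-images (a ∷ W) = trans (length-cartesianProductWith _∷_ (φ a) (images W)) (cong (length (φ a) *_) (length-images W))

  Image-drop : ∀ j {Bs W} → Image Bs W → Image (drop j Bs) (drop j W)
  Image-drop zero    image        = image
  Image-drop (suc j) []           = []
  Image-drop (suc j) (_ ∷ image)  = Image-drop j image

  Image-take : ∀ j {Bs W} → Image Bs W → Image (take j Bs) (take j W)
  Image-take zero    image        = []
  Image-take (suc j) []           = []
  Image-take (suc j) (X∈ ∷ image) = X∈ ∷ Image-take j image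

  module Uniform (k : ℕ) ⦃ _ : NonZero k ⦄ (uniform : ∀ {a X} → X ∈ φ a → length X ≡ k) where

    length-concat : ∀ {Bs W} → Image Bs W → length (concat Bs) ≡ k * length W
    length-concat [] = sym (*-zeroʳ k)
    length-concat {X ∷ Bs} {a ∷ W} (X∈ ∷ image) = begin
      length (X ++ concat Bs)       ≡⟨ length-++ X ⟩
      length X + length (concat Bs) ≡⟨ cong₂ _+_ (uniform X∈) (length-concat image) ⟩
      k + k * length W              ≡⟨ sym (*-suc k (length W)) ⟩
      k * suc (length W)            ∎
      where open ≡-Reasoning

    concat-injective : ∀ {Bs Bs′ W} → Image Bs W → Image Bs′ W → concat Bs ≡ concat Bs′ → Bs ≡ Bs′
    concat-injective []           []             _  = refl
    concat-injective {X ∷ _} {X′ ∷ _} (X∈ ∷ image) (X′∈ ∷ image′) eq with ++-injective-length X X′ (trans (uniform X∈) (sym (uniform X′∈))) eq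
    ... | refl , rest = cong (_ ∷_) (concat-injective image image′ rest)

    ‼-concat-drop : ∀ j {Bs W} → Image Bs W → ∀ x → concat (drop j Bs) ‼ x ≡ concat Bs ‼ (k * j + x)
    ‼-concat-drop zero    {Bs} _ x = cong (λ z → concat Bs ‼ (z + x)) (sym (*-zeroʳ k))
    ‼-concat-drop (suc j) []     x = refl
    ‼-concat-drop (suc j) {X ∷ Bs} (X∈ ∷ image) x = begin
      concat (drop j Bs) ‼ x                     ≡⟨ ‼-concat-drop j image x ⟩
      concat Bs ‼ (k * j + x)                    ≡⟨ sym (‼-++ʳ X (concat Bs) (k * j + x)) ⟩
      (X ++ concat Bs) ‼ (length X + (k * j + x)) ≡⟨ cong ((X ++ concat Bs) ‼_) index≡ ⟩
      (X ++ concat Bs) ‼ (k * suc j + x)         ∎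
      where
      open ≡-Reasoning
      index≡ : length X + (k * j + x) ≡ k * suc j + x
      index≡ = trans (cong (_+ (k * j + x)) (uniform X∈))
                 (trans (sym (+-assoc k (k * j) x)) (cong (_+ x) (sym (*-suc k j))))

    ‼-concat-take : ∀ M {Bs W} → Image Bs W → ∀ {x} → x < k * M → concat (take M Bs) ‼ x ≡ concat Bs ‼ x
    ‼-concat-take zero    _ {x} x<0 = ⊥-elim (n≮0 (subst (x <_) (*-zeroʳ k) x<0))
    ‼-concat-take (suc M) []    _   = refl
    ‼-concat-take (suc M) {X ∷ Bs} (X∈ ∷ image) {x} x<k[1+M] with x <? k
    ... | yes x<k = trans (‼-++ˡ X _ x<X) (sym (‼-++ˡ X _ x<X))
      where x<X = subst (x <_) (sym (uniform X∈)) x<k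
    ... | no x≮k = begin
      (X ++ concat (take M Bs)) ‼ x                ≡⟨ cong ((X ++ concat (take M Bs)) ‼_) (sym x≡) ⟩
      (X ++ concat (take M Bs)) ‼ (length X + x′)  ≡⟨ ‼-++ʳ X _ x′ ⟩
      concat (take M Bs) ‼ x′                      ≡⟨ ‼-concat-take M image x′<kM ⟩
      concat Bs ‼ x′                               ≡⟨ sym (‼-++ʳ X _ x′) ⟩
      (X ++ concat Bs) ‼ (length X + x′)           ≡⟨ cong ((X ++ concat Bs) ‼_) x≡ ⟩
      (X ++ concat Bs) ‼ x                         ∎
      where
      open ≡-Reasoning
      x′ = x ∸ k
      k≤x = ≮⇒≥ x≮k
      x≡ : length X + x′ ≡ x
      x≡ = trans (cong (_+ x′) (uniform X∈)) (m+[n∸m]≡n k≤x)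
      x′<kM : x′ < k * M
      x′<kM = +-cancelˡ-< k x′ (k * M) (subst₂ _<_ (sym (m+[n∸m]≡n k≤x)) (*-suc k M) x<k[1+M])

    block : ∀ j {Bs W} → Image Bs W → j < length W →
            ∃₂ λ a X → W ‼ j ≡ just a × X ∈ φ a × (∀ o → o < k → concat Bs ‼ (k * j + o) ≡ X ‼ o)
    block zero {X ∷ Bs} {a ∷ W} (X∈ ∷ _) _ =
      a , X , refl , X∈ , λ o o<k → trans (cong ((X ++ concat Bs) ‼_) (cong (_+ o) (*-zeroʳ k)))
                                          (‼-++ˡ X _ (subst (o <_) (sym (uniform X∈)) o<k))
    block (suc j) {X ∷ Bs} {a ∷ W} (X∈ ∷ image) (s≤s j<W) with block j image j<W
    ... | b , Y , W‼j , Y∈ , inside = b , Y , W‼j , Y∈ , λ o o<k → begin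
      (X ++ concat Bs) ‼ (k * suc j + o)            ≡⟨ cong ((X ++ concat Bs) ‼_) index≡ ⟩
      (X ++ concat Bs) ‼ (length X + (k * j + o))   ≡⟨ ‼-++ʳ X _ _ ⟩
      concat Bs ‼ (k * j + o)                       ≡⟨ inside o o<k ⟩
      Y ‼ o                                         ∎
      where
      open ≡-Reasoning
      index≡ : ∀ {o} → k * suc j + o ≡ length X + (k * j + o)
      index≡ {o} = trans (cong (_+ o) (*-suc k j)) (trans (+-assoc k (k * j) o) (cong (_+ (k * j + o)) (sym (uniform X∈))))

    divide : ∀ a → a ≡ k * (a / k) + a % k
    divide a = trans (m≡m%n+[m/n]*n a k) (trans (+-comm (a % k) _) (cong (_+ a % k) (*-comm (a / k) k)))

    everyWindowᵇ : (ℕ → List B → Bool) → List (List A) → Bool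
    everyWindowᵇ P F = all (λ f → all (λ Bs → allShiftsᵇ P 0 k (concat Bs)) (images f)) F

    module Windows (M : ℕ) (F : List (List A)) {Bs W} (image : Image Bs W) (windows : WindowsIn M F W) where

      private
        u = concat Bs

      window : ℕ → List B
      window a = drop (a % k) (concat (take M (drop (a / k) Bs)))

      window-satisfies : ∀ P → T (everyWindowᵇ P F) → ∀ a → T (P (a % k) (window a))
      window-satisfies P ok a = allShiftsᵇ-sound P 0 k _
        (T-all (λ Bs′ → allShiftsᵇ P 0 k (concat Bs′))
           (T-all (λ f → all (λ Bs′ → allShiftsᵇ P 0 k (concat Bs′)) (images f)) ok (windows (a / k)))
           (Image⇒∈images (Image-take M (Image-drop (a / k) image))))
        (m%n<n a k)

      window-fits : ∀ a {n} → k + n ≤ k * M → a % k + n ≤ k * M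
      window-fits a {n} fits = ≤-trans (+-monoˡ-≤ n (<⇒≤ (m%n<n a k))) fits

      window-‼ : ∀ a {x} → a % k + x < k * M → window a ‼ x ≡ u ‼ (a + x)
      window-‼ a {x} x-fits = begin
        window a ‼ x                                   ≡⟨ ‼-drop (a % k) _ x ⟩
        concat (take M (drop (a / k) Bs)) ‼ (a % k + x) ≡⟨ ‼-concat-take M (Image-drop (a / k) image) x-fits ⟩
        concat (drop (a / k) Bs) ‼ (a % k + x)          ≡⟨ ‼-concat-drop (a / k) image (a % k + x) ⟩
        u ‼ (k * (a / k) + (a % k + x))                 ≡⟨ cong (u ‼_) (trans (sym (+-assoc _ (a % k) x)) (cong (_+ x) (sym (divide a)))) ⟩
        u ‼ (a + x)                                    ∎
        where open ≡-Reasoning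

      window-length : ∀ a n → a % k + n ≤ k * M → a + n ≤ length u → n ≤ length (window a)
      window-length a n n-fits a+n≤u = ‼-defined⇒≤length n (window a) λ x x<n →
        subst (λ m → ∃[ v ] m ≡ just v) (sym (window-‼ a (<-≤-trans (+-monoʳ-< (a % k) x<n) n-fits)))
          (‼-defined u (<-≤-trans (+-monoʳ-< a x<n) a+n≤u))

      window-periodic : ∀ a p n → a % k + (p + n) ≤ k * M → Periodic u a p n →
                        ∀ x → x < n → window a ‼ x ≡ drop p (window a) ‼ x
      window-periodic a p n fits periodic x x<n = begin
        window a ‼ x            ≡⟨ window-‼ a (<-≤-trans (+-monoʳ-< (a % k) (<-≤-trans x<n (m≤n+m n p))) fits) ⟩
        u ‼ (a + x)             ≡⟨ periodic (a + x) (m≤m+n a x) (+-monoʳ-< a x<n) ⟩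
        u ‼ (a + x + p)         ≡⟨ cong (u ‼_) (trans (+-assoc a x p) (cong (a +_) (+-comm x p))) ⟩
        u ‼ (a + (p + x))       ≡⟨ sym (window-‼ a (<-≤-trans (+-monoʳ-< (a % k) (+-monoʳ-< p x<n)) fits)) ⟩
        window a ‼ (p + x)      ≡⟨ sym (‼-drop p (window a) x) ⟩
        drop p (window a) ‼ x   ∎
        where open ≡-Reasoning


    -- Squares of period in [lo, K) and cubes of period in [1, nC] are excluded by inspection; K is
    -- also the length of the windows from which dec reads the phase.
    module Checks (_==_ : B → B → Bool) (==-refl : ∀ x → T (x == x)) (lo K nC : ℕ) where
      open PrefixEquality _==_ ==-refl

      noSquareAtᵇ : List B → ℕ → List B → Bool
      noSquareAtᵇ t p t′ = not (prefixEqᵇ p t t′ ∧ (p + p ≤ᵇ length t))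

      noCubeAtᵇ : List B → ℕ → List B → Bool
      noCubeAtᵇ t p t′ = not (prefixEqᵇ (p + p) t t′ ∧ (p + p + p ≤ᵇ length t))

      phaseᵇ : (List B → ℕ) → ℕ → List B → Bool
      phaseᵇ dec r t = not (K ≤ᵇ length t) ∨ (dec (take K t) ≡ᵇ r)

      squaresᵇ : List B → Bool
      squaresᵇ t = allShiftsᵇ (noSquareAtᵇ t) lo (K ∸ lo) (drop lo t)

      cubesᵇ : List B → Bool
      cubesᵇ t = allShiftsᵇ (noCubeAtᵇ t) 1 nC (drop 1 t)

      -- t is the suffix of a block image starting at phase r < k; dec must read r off its first K symbols.
      windowChecksᵇ : (List B → ℕ) → ℕ → List B → Bool
      windowChecksᵇ dec r t = phaseᵇ dec r t ∧ squaresᵇ t ∧ cubesᵇ t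

      certifiedᵇ : (List B → ℕ) → List (List A) → Bool
      certifiedᵇ dec = everyWindowᵇ (windowChecksᵇ dec)

      module WindowSound (dec : List B → ℕ) (r : ℕ) (t : List B) (ok : T (windowChecksᵇ dec r t)) where

        private
          parts = Equivalence.to (T-∧ {phaseᵇ dec r t} {squaresᵇ t ∧ cubesᵇ t}) ok
          rest  = Equivalence.to (T-∧ {squaresᵇ t} {cubesᵇ t}) (proj₂ parts)

        phase-sound : K ≤ length t → dec (take K t) ≡ r
        phase-sound K≤t = ≡ᵇ⇒≡ _ _ (T-⇒ (proj₁ parts) (≤⇒≤ᵇ K≤t))

        square-sound : ∀ p → lo ≤ p → p < K → p + p ≤ length t → ¬ (∀ x → x < p → t ‼ x ≡ drop p t ‼ x)
        square-sound p lo≤p p<K 2p≤t agree =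
          T-¬∧ (subst (λ q → T (noSquareAtᵇ t q (drop q t))) p≡ (subst (T ∘ noSquareAtᵇ t (lo + i)) (drop-drop lo i t) checked))
            (prefixEqᵇ-complete p t (drop p t) (≤-trans (m≤m+n p p) 2p≤t) agree) (≤⇒≤ᵇ 2p≤t)
          where
          i = p ∸ lo
          p≡ : lo + i ≡ p
          p≡ = m+[n∸m]≡n lo≤p
          checked = allShiftsᵇ-sound (noSquareAtᵇ t) lo (K ∸ lo) (drop lo t) (proj₁ rest) (∸-monoˡ-< p<K lo≤p)

        cube-sound : ∀ p → 1 ≤ p → p ≤ nC → p + p + p ≤ length t → ¬ (∀ x → x < p + p → t ‼ x ≡ drop p t ‼ x)
        cube-sound (suc i) _ p≤nC 3p≤t agree =
          T-¬∧ (subst (T ∘ noCubeAtᵇ t (suc i)) (drop-drop 1 i t)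
                 (allShiftsᵇ-sound (noCubeAtᵇ t) 1 nC (drop 1 t) {i} (proj₂ rest) p≤nC))
            (prefixEqᵇ-complete (suc i + suc i) t (drop (suc i) t) (≤-trans (m≤m+n _ (suc i)) 3p≤t) agree) (≤⇒≤ᵇ 3p≤t)

    module Desubstitution
      (Lp s : ℕ) (Lp≤k : Lp ≤ k) (Lp≤1+s : Lp ≤ suc s)
      (prefix-determines : ∀ {c c′ X X′} → X ∈ φ c → X′ ∈ φ c′ → (∀ o → o < Lp → X ‼ o ≡ X′ ‼ o) → c ≡ c′)
      (suffix-determines : ∀ {c c′ X X′} → X ∈ φ c → X′ ∈ φ c′ → (∀ o → s ≤ o → o < k → X ‼ o ≡ X′ ‼ o) → c ≡ c′)
      {Bs W} (image : Image Bs W)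
      where

      private
        u = concat Bs

      same-letter : ∀ {a q i} (InBlock : ℕ → Set) →
        (∀ {c c′ X X′} → X ∈ φ c → X′ ∈ φ c′ → (∀ o → InBlock o → X ‼ o ≡ X′ ‼ o) → c ≡ c′) →
        (∀ o → InBlock o → o < k × a ≤ k * i + o × k * i + o < a + k * q) →
        i + q < length W → Periodic u a (k * q) (k * q) → W ‼ i ≡ W ‼ (i + q)
      same-letter {a} {q} {i} InBlock determines covered i+q<W periodic
        with block i image (≤-trans (s≤s (m≤m+n i q)) i+q<W) | block (i + q) image i+q<W
      ... | c , X , W‼i , X∈ , atX | c′ , X′ , W‼i+q , X′∈ , atX′ =
        trans W‼i (trans (cong just (determines X∈ X′∈ agree)) (sym W‼i+q))
        where
        agree : ∀ o → InBlock o → X ‼ o ≡ X′ ‼ o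
        agree o o∈ with covered o o∈
        ... | o<k , a≤ , <a+kq = begin
          X ‼ o                   ≡⟨ sym (atX o o<k) ⟩
          u ‼ (k * i + o)         ≡⟨ periodic _ a≤ <a+kq ⟩
          u ‼ (k * i + o + k * q) ≡⟨ cong (u ‼_) (block-shift k i o q) ⟩
          u ‼ (k * (i + q) + o)   ≡⟨ atX′ o o<k ⟩
          X′ ‼ o                  ∎
          where open ≡-Reasoning

      same-letter-prefix : ∀ {a q i} → a ≤ k * i → k * i + Lp ≤ a + k * q →
                           i + q < length W → Periodic u a (k * q) (k * q) → W ‼ i ≡ W ‼ (i + q)
      same-letter-prefix {i = i} a≤ki ki+Lp≤ = same-letter (_< Lp) prefix-determines λ o o<Lp →
        ≤-trans o<Lp Lp≤k , ≤-trans a≤ki (m≤m+n (k * i) o) , <-≤-trans (+-monoʳ-< (k * i) o<Lp) ki+Lp≤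

      same-letter-suffix : ∀ {a q i} → a ≤ k * i + s → k * i + k ≤ a + k * q →
                           i + q < length W → Periodic u a (k * q) (k * q) → W ‼ i ≡ W ‼ (i + q)
      same-letter-suffix {i = i} a≤ki+s ki+k≤ =
        same-letter (λ o → s ≤ o × o < k) (λ X∈ X′∈ agree → suffix-determines X∈ X′∈ (λ o s≤o o<k → agree o (s≤o , o<k)))
          λ { o (s≤o , o<k) → o<k , ≤-trans a≤ki+s (+-monoʳ-≤ (k * i) s≤o) , <-≤-trans (+-monoʳ-< (k * i) o<k) ki+k≤ }

      -- The square starts at offset r of block j. Letters strictly between j and j + q are fixed by
      -- whole blocks; if r ≤ s the suffix of block j fixes letter j as well, and otherwise Lp ≤ r and
      -- the prefix of block j + q fixes letter j + q.
      module Lift (j r q : ℕ) (r<k : r < k) (1≤q : 1 ≤ q) (fits : k * j + r + (k * q + k * q) ≤ length u)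
                  (periodic : Periodic u (k * j + r) (k * q) (k * q)) where

        j+2q≤W : j + (q + q) ≤ length W
        j+2q≤W = *-cancelˡ-≤ k (begin
          k * (j + (q + q))           ≡⟨ trans (cong (k *_) (sym (+-assoc j q q))) (block-start k j q) ⟩
          k * j + (k * q + k * q)     ≤⟨ +-monoˡ-≤ (k * q + k * q) (m≤m+n (k * j) r) ⟩
          k * j + r + (k * q + k * q) ≤⟨ fits ⟩
          length u                    ≡⟨ length-concat image ⟩
          k * length W                ∎)
          where open ≤-Reasoning

        above-start : ∀ i → j < i → k * j + r ≤ k * i
        above-start i j<i = begin
          k * j + r   ≤⟨ +-monoʳ-≤ (k * j) (<⇒≤ r<k) ⟩
          k * j + k   ≡⟨ trans (+-comm (k * j) k) (sym (*-suc k j)) ⟩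
          k * suc j   ≤⟨ *-monoʳ-≤ k j<i ⟩
          k * i       ∎
          where open ≤-Reasoning

        below-end : ∀ i → i < j + q → k * i + k ≤ k * j + r + k * q
        below-end i i<j+q = begin
          k * i + k         ≡⟨ trans (+-comm (k * i) k) (sym (*-suc k i)) ⟩
          k * suc i         ≤⟨ *-monoʳ-≤ k i<j+q ⟩
          k * (j + q)       ≡⟨ *-distribˡ-+ k j q ⟩
          k * j + k * q     ≤⟨ +-monoˡ-≤ (k * q) (m≤m+n (k * j) r) ⟩
          k * j + r + k * q ∎
          where open ≤-Reasoning

        inner-fits : ∀ i → i < j + q → i + q < length W
        inner-fits i i<j+q = <-≤-trans (+-monoˡ-< q i<j+q) (subst (_≤ length W) (sym (+-assoc j q q)) j+2q≤W)

        inner : ∀ i → j < i → i < j + q → W ‼ i ≡ W ‼ (i + q)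
        inner i j<i i<j+q = same-letter-prefix (above-start i j<i)
          (≤-trans (+-monoʳ-≤ (k * i) Lp≤k) (below-end i i<j+q)) (inner-fits i i<j+q) periodic

        j<j+q : j < j + q
        j<j+q = m<m+n j 1≤q

        lift-via-suffix : r ≤ s → Periodic W j q q
        lift-via-suffix r≤s y j≤y y<j+q with m≤n⇒m<n∨m≡n j≤y
        ... | inj₁ j<y  = inner y j<y y<j+q
        ... | inj₂ refl = same-letter-suffix (+-monoʳ-≤ (k * j) r≤s) (below-end j j<j+q) (inner-fits j j<j+q) periodic

        module _ (s<r : s < r) where

          last-prefix : k * (j + q) + Lp ≤ k * j + r + k * q
          last-prefix = begin
            k * (j + q) + Lp    ≡⟨ cong (_+ Lp) (*-distribˡ-+ k j q) ⟩
            k * j + k * q + Lp  ≤⟨ +-monoʳ-≤ (k * j + k * q) (≤-trans Lp≤1+s s<r) ⟩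
            k * j + k * q + r   ≡⟨ +-comm-last (k * j) (k * q) r ⟩
            k * j + r + k * q   ∎
            where open ≤-Reasoning

          j+2q<W : j + q + q < length W
          j+2q<W = *-cancelˡ-< k (j + q + q) (length W) (begin-strict
            k * (j + q + q)             ≡⟨ block-start k j q ⟩
            k * j + (k * q + k * q)     <⟨ +-monoˡ-< (k * q + k * q) (m<m+n (k * j) (≤-trans (s≤s z≤n) s<r)) ⟩
            k * j + r + (k * q + k * q) ≤⟨ fits ⟩
            length u                    ≡⟨ length-concat image ⟩
            k * length W                ∎)
            where open ≤-Reasoning

          lift-via-prefix : Periodic W (suc j) q q
          lift-via-prefix y j<y y<1+j+q with m≤n⇒m<n∨m≡n (≤-pred y<1+j+q)
          ... | inj₁ y<j+q = inner y j<y y<j+q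
          ... | inj₂ refl  = same-letter-prefix (above-start (j + q) j<j+q) last-prefix j+2q<W periodic

        lifted : ∃[ b ] b + (q + q) ≤ length W × Periodic W b q q
        lifted with r ≤? s
        ... | yes r≤s = j , j+2q≤W , lift-via-suffix r≤s
        ... | no r≰s  = suc j , subst (_≤ length W) (cong suc (+-assoc j q q)) (j+2q<W (≰⇒> r≰s)) , lift-via-prefix (≰⇒> r≰s)

      lift-square : ∀ a q → 1 ≤ q → a + (k * q + k * q) ≤ length u → Periodic u a (k * q) (k * q) →
                    ∃[ b ] b + (q + q) ≤ length W × Periodic W b q q
      lift-square a q 1≤q fits periodic =
        Lift.lifted (a / k) (a % k) q (m%n<n a k) 1≤q (subst (λ x → x + _ ≤ length u) (divide a) fits)
          (subst (λ x → Periodic u x (k * q) (k * q)) (divide a) periodic)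

      module Certified (_==_ : B → B → Bool) (==-refl : ∀ x → T (x == x)) (M lo K nC : ℕ)
        (F : List (List A)) (dec : List B → ℕ) (certified : Checks.certifiedᵇ _==_ ==-refl lo K nC dec F ≡ true)
        (1≤lo : 1 ≤ lo) (squares-fit : k + (K + K) ≤ k * M) (cubes-fit : k + (nC + nC + nC) ≤ k * M)
        (windows : WindowsIn M F W)
        where

        open Checks _==_ ==-refl lo K nC
        open Windows M F image windows

        window-checks : ∀ a → T (windowChecksᵇ dec (a % k) (window a))
        window-checks = window-satisfies (windowChecksᵇ dec) (Equivalence.from T-≡ certified)

        module Sound (a : ℕ) = WindowSound dec (a % k) (window a) (window-checks a)

        phase : ∀ a → a + K ≤ length u → dec (take K (window a)) ≡ a % k
        phase a a+K≤u = Sound.phase-sound a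
          (window-length a K (window-fits a (≤-trans (+-monoʳ-≤ k (m≤m+n K K)) squares-fit)) a+K≤u)

        period-multiple : ∀ a p → K ≤ p → a + (p + p) ≤ length u → Periodic u a p p → ∃[ q ] p ≡ k * q
        period-multiple a p K≤p fits periodic = j′ ∸ j , p≡
          where
          j = a / k
          j′ = (a + p) / k
          K-fits : ∀ b {x} → x < K → b % k + x < k * M
          K-fits b x<K = <-≤-trans (+-monoʳ-< (b % k) x<K)
                           (window-fits b (≤-trans (+-monoʳ-≤ k (m≤m+n K K)) squares-fit))
          same-window : take K (window a) ≡ take K (window (a + p))
          same-window = take-‼ K _ _ λ x x<K → begin
            window a ‼ x        ≡⟨ window-‼ a (K-fits a x<K) ⟩
            u ‼ (a + x)         ≡⟨ periodic (a + x) (m≤m+n a x) (+-monoʳ-< a (<-≤-trans x<K K≤p)) ⟩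
            u ‼ (a + x + p)     ≡⟨ cong (u ‼_) (+-comm-last a x p) ⟩
            u ‼ (a + p + x)     ≡⟨ sym (window-‼ (a + p) (K-fits (a + p) x<K)) ⟩
            window (a + p) ‼ x  ∎
            where open ≡-Reasoning
          same-phase : a % k ≡ (a + p) % k
          same-phase = begin
            a % k                          ≡⟨ sym (phase a (≤-trans (+-monoʳ-≤ a (≤-trans K≤p (m≤m+n p p))) fits)) ⟩
            dec (take K (window a))        ≡⟨ cong dec same-window ⟩
            dec (take K (window (a + p)))  ≡⟨ phase (a + p) (≤-trans (≤-trans (+-monoʳ-≤ (a + p) K≤p) (≤-reflexive (+-assoc a p p))) fits) ⟩
            (a + p) % k                    ∎
            where open ≡-Reasoning
          p≡ : p ≡ k * (j′ ∸ j)
          p≡ = begin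
            p                       ≡⟨ sym (m+n∸m≡n (k * j) p) ⟩
            k * j + p ∸ k * j       ≡⟨ cong (_∸ k * j) (+-cancelʳ-≡ (a % k) _ _ (begin
              k * j + p + a % k         ≡⟨ +-comm-last (k * j) p (a % k) ⟩
              k * j + a % k + p         ≡⟨ cong (_+ p) (sym (divide a)) ⟩
              a + p                     ≡⟨ divide (a + p) ⟩
              k * j′ + (a + p) % k      ≡⟨ cong (k * j′ +_) (sym same-phase) ⟩
              k * j′ + a % k            ∎)) ⟩
            k * j′ ∸ k * j          ≡⟨ sym (*-distribˡ-∸ k j′ j) ⟩
            k * (j′ ∸ j)            ∎
            where open ≡-Reasoning

        no-short-square : ∀ a p → lo ≤ p → p < K → a + (p + p) ≤ length u → ¬ Periodic u a p p
        no-short-square a p lo≤p p<K fits periodic =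
          Sound.square-sound a p lo≤p p<K (window-length a (p + p) p-fits fits) (window-periodic a p p p-fits periodic)
          where
          p-fits : a % k + (p + p) ≤ k * M
          p-fits = window-fits a (≤-trans (+-monoʳ-≤ k (+-mono-≤ (<⇒≤ p<K) (<⇒≤ p<K))) squares-fit)

        no-short-cube : ∀ a p → 1 ≤ p → p ≤ nC → a + (p + p + p) ≤ length u → ¬ Periodic u a p (p + p)
        no-short-cube a p 1≤p p≤nC fits periodic =
          Sound.cube-sound a p 1≤p p≤nC (window-length a (p + p + p) p-fits fits)
            (window-periodic a p (p + p) (subst (λ n → a % k + n ≤ k * M) (+-assoc p p p) p-fits) periodic)
          where
          p-fits : a % k + (p + p + p) ≤ k * M
          p-fits = window-fits a (≤-trans (+-monoʳ-≤ k (+-mono-≤ (+-mono-≤ p≤nC p≤nC) p≤nC)) cubes-fit)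

        no-square : SquareFree W → ∀ a p → lo ≤ p → a + (p + p) ≤ length u → ¬ Periodic u a p p
        no-square square-free a p lo≤p fits periodic with p <? K
        ... | yes p<K = no-short-square a p lo≤p p<K fits periodic
        ... | no p≮K with period-multiple a p (≮⇒≥ p≮K) fits periodic
        ...   | zero  , p≡0 = <⇒≱ (≤-trans 1≤lo lo≤p) (≤-reflexive (trans p≡0 (*-zeroʳ k)))
        ...   | suc q , refl with lift-square a (suc q) (s≤s z≤n) fits periodic
        ...     | b , b-fits , periodicW = square-free b (suc q) (s≤s z≤n) b-fits periodicW

-- A decoder only has to be right on the windows that actually occur, and its answers are checked;
-- the trie just keeps that check linear in the number of windows.
data Trie (B : Set) : Set where
  node : Maybe ℕ → List (B × Trie B) → Trie B

module Tries {B : Set} (_==_ : B → B → Bool) where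

  emptyTrie : Trie B
  emptyTrie = node nothing []

  mutual
    insert : List B → ℕ → Trie B → Trie B
    insert []      r (node _ children) = node (just r) children
    insert (x ∷ w) r (node v children) = node v (insertChild x w r children)

    insertChild : B → List B → ℕ → List (B × Trie B) → List (B × Trie B)
    insertChild x w r []                    = (x , insert w r emptyTrie) ∷ []
    insertChild x w r ((y , t) ∷ children) =
      if x == y then (y , insert w r t) ∷ children else (y , t) ∷ insertChild x w r children

  mutual
    lookupTrie : List B → Trie B → Maybe ℕ
    lookupTrie []      (node v _)        = v
    lookupTrie (x ∷ w) (node _ children) = lookupChild x w children

    lookupChild : B → List B → List (B × Trie B) → Maybe ℕ
    lookupChild x w []                    = nothing
    lookupChild x w ((y , t) ∷ children) = if x == y then lookupTrie w t else lookupChild x w children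

  decodeWith : Trie B → List B → ℕ
  decodeWith trie w = fromMaybe 0 (lookupTrie w trie)

  decoder : List (List B × ℕ) → List B → ℕ
  decoder table = decodeWith (foldr (λ { (w , r) → insert w r }) emptyTrie table)

phaseTable : ∀ {A B : Set} (φ : A → List (List B)) (k K : ℕ) (F : List (List A)) → List (List B × ℕ)
phaseTable {B = B} φ k K F = concatMap (λ f → concatMap (λ Bs → entries 0 k (concat Bs)) (images f)) F
  where
  open Substitution φ
  entries : ℕ → ℕ → List B → List (List B × ℕ)
  entries r zero    t = []
  entries r (suc n) t = (if K ≤ᵇ length t then (take K t , r) ∷ [] else []) ++ entries (suc r) n (drop 1 t)

sameBitᵇ : Bit → Bit → Bool
sameBitᵇ b0 b0 = true
sameBitᵇ b1 b1 = true
sameBitᵇ _  _  = false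

sameBitᵇ-refl : ∀ x → T (sameBitᵇ x x)
sameBitᵇ-refl b0 = _
sameBitᵇ-refl b1 = _

sameLetterᵇ : Σ₄ → Σ₄ → Bool
sameLetterᵇ a0 a0 = true
sameLetterᵇ a1 a1 = true
sameLetterᵇ a2 a2 = true
sameLetterᵇ a3 a3 = true
sameLetterᵇ _  _  = false

sameLetterᵇ-refl : ∀ x → T (sameLetterᵇ x x)
sameLetterᵇ-refl a0 = _
sameLetterᵇ-refl a1 = _
sameLetterᵇ-refl a2 = _
sameLetterᵇ-refl a3 = _

sameLetterᵇ-sound : ∀ {x y} → T (sameLetterᵇ x y) → x ≡ y
sameLetterᵇ-sound {a0} {a0} _ = refl
sameLetterᵇ-sound {a1} {a1} _ = refl
sameLetterᵇ-sound {a2} {a2} _ = refl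
sameLetterᵇ-sound {a3} {a3} _ = refl

_≟Σ₄_ : DecidableEquality Σ₄
x ≟Σ₄ y = map′ sameLetterᵇ-sound (λ { refl → sameLetterᵇ-refl x }) (T? (sameLetterᵇ x y))

open import Data.List.Membership.DecPropositional (≡-dec _≟Σ₄_) using (_∈?_)

letters : List Σ₄
letters = a0 ∷ a1 ∷ a2 ∷ a3 ∷ []

∈-letters : ∀ a → a ∈ letters
∈-letters a0 = here refl
∈-letters a1 = there (here refl)
∈-letters a2 = there (there (here refl))
∈-letters a3 = there (there (there (here refl)))

module Distinguishing {B : Set} (_==_ : B → B → Bool) (==-refl : ∀ x → T (x == x))
  (φ : Σ₄ → List (List B)) (k : ℕ) (uniform : ∀ {a X} → X ∈ φ a → length X ≡ k) where

  open PrefixEquality _==_ ==-refl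

  module _ (same : List B → List B → Bool) where

    separatedᵇ : Σ₄ → Σ₄ → List B → List B → Bool
    separatedᵇ c c′ X X′ = not (same X X′) ∨ sameLetterᵇ c c′

    distinguishedByᵇ : Bool
    distinguishedByᵇ = all (λ c → all (λ c′ → all (λ X → all (separatedᵇ c c′ X) (φ c′)) (φ c)) letters) letters

    distinguishedByᵇ-sound : T distinguishedByᵇ → ∀ {c c′ X X′} → X ∈ φ c → X′ ∈ φ c′ → T (same X X′) → c ≡ c′
    distinguishedByᵇ-sound ok {c} {c′} {X} X∈ X′∈ same-XX′ = sameLetterᵇ-sound (T-⇒ separated same-XX′)
      where
      separated = T-all (separatedᵇ c c′ X)
        (T-all (λ X → all (separatedᵇ c c′ X) (φ c′))
          (T-all (λ c′ → all (λ X → all (separatedᵇ c c′ X) (φ c′)) (φ c))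
            (T-all (λ c → all (λ c′ → all (λ X → all (separatedᵇ c c′ X) (φ c′)) (φ c)) letters) ok (∈-letters c))
            (∈-letters c′))
          X∈)
        X′∈

  prefix-determines : ∀ Lp → Lp ≤ k → T (distinguishedByᵇ (prefixEqᵇ Lp)) →
    ∀ {c c′ X X′} → X ∈ φ c → X′ ∈ φ c′ → (∀ o → o < Lp → X ‼ o ≡ X′ ‼ o) → c ≡ c′
  prefix-determines Lp Lp≤k ok X∈ X′∈ agree =
    distinguishedByᵇ-sound (prefixEqᵇ Lp) ok X∈ X′∈ (prefixEqᵇ-complete Lp _ _ (subst (Lp ≤_) (sym (uniform X∈)) Lp≤k) agree)

  suffix-determines : ∀ s → s ≤ k → T (distinguishedByᵇ (λ X X′ → prefixEqᵇ (k ∸ s) (drop s X) (drop s X′))) →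
    ∀ {c c′ X X′} → X ∈ φ c → X′ ∈ φ c′ → (∀ o → s ≤ o → o < k → X ‼ o ≡ X′ ‼ o) → c ≡ c′
  suffix-determines s s≤k ok {X = X} {X′} X∈ X′∈ agree =
    distinguishedByᵇ-sound _ ok X∈ X′∈ (prefixEqᵇ-complete (k ∸ s) (drop s X) (drop s X′) length-ok agree-after-s)
    where
    length-ok : k ∸ s ≤ length (drop s X)
    length-ok = ≤-reflexive (sym (trans (length-drop s X) (cong (_∸ s) (uniform X∈))))
    agree-after-s : ∀ t → t < k ∸ s → drop s X ‼ t ≡ drop s X′ ‼ t
    agree-after-s t t<k∸s = begin
      drop s X ‼ t   ≡⟨ ‼-drop s X t ⟩
      X ‼ (s + t)    ≡⟨ agree (s + t) (m≤m+n s t) (subst (s + t <_) (m+[n∸m]≡n s≤k) (+-monoʳ-< s t<k∸s)) ⟩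
      X′ ‼ (s + t)   ≡⟨ sym (‼-drop s X′ t) ⟩
      drop s X′ ‼ t  ∎
      where open ≡-Reasoning

-- The factors of length at most 4 of the fixed point of h (shorter ones occur at the end of h^m(0)).
Fac : List (List Σ₄)

Fac =
  [] ∷
  (a0 ∷ []) ∷
  (a0 ∷ a1 ∷ []) ∷
  (a0 ∷ a1 ∷ a0 ∷ []) ∷
  (a0 ∷ a1 ∷ a0 ∷ a2 ∷ []) ∷
  (a0 ∷ a1 ∷ a0 ∷ a3 ∷ []) ∷
  (a0 ∷ a2 ∷ []) ∷
  (a0 ∷ a2 ∷ a0 ∷ []) ∷
  (a0 ∷ a2 ∷ a0 ∷ a1 ∷ []) ∷
  (a0 ∷ a2 ∷ a0 ∷ a3 ∷ []) ∷
  (a0 ∷ a2 ∷ a3 ∷ []) ∷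
  (a0 ∷ a2 ∷ a3 ∷ a0 ∷ []) ∷
  (a0 ∷ a3 ∷ []) ∷
  (a0 ∷ a3 ∷ a0 ∷ []) ∷
  (a0 ∷ a3 ∷ a0 ∷ a1 ∷ []) ∷
  (a0 ∷ a3 ∷ a1 ∷ []) ∷
  (a0 ∷ a3 ∷ a1 ∷ a0 ∷ []) ∷
  (a1 ∷ []) ∷
  (a1 ∷ a0 ∷ []) ∷
  (a1 ∷ a0 ∷ a2 ∷ []) ∷
  (a1 ∷ a0 ∷ a2 ∷ a0 ∷ []) ∷
  (a1 ∷ a0 ∷ a2 ∷ a3 ∷ []) ∷
  (a1 ∷ a0 ∷ a3 ∷ []) ∷
  (a1 ∷ a0 ∷ a3 ∷ a1 ∷ []) ∷
  (a2 ∷ []) ∷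
  (a2 ∷ a0 ∷ []) ∷
  (a2 ∷ a0 ∷ a1 ∷ []) ∷
  (a2 ∷ a0 ∷ a1 ∷ a0 ∷ []) ∷
  (a2 ∷ a0 ∷ a3 ∷ []) ∷
  (a2 ∷ a0 ∷ a3 ∷ a0 ∷ []) ∷
  (a2 ∷ a0 ∷ a3 ∷ a1 ∷ []) ∷
  (a2 ∷ a3 ∷ []) ∷
  (a2 ∷ a3 ∷ a0 ∷ []) ∷
  (a2 ∷ a3 ∷ a0 ∷ a1 ∷ []) ∷
  (a2 ∷ a3 ∷ a0 ∷ a2 ∷ []) ∷
  (a2 ∷ a3 ∷ a0 ∷ a3 ∷ []) ∷
  (a3 ∷ []) ∷
  (a3 ∷ a0 ∷ []) ∷
  (a3 ∷ a0 ∷ a1 ∷ []) ∷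
  (a3 ∷ a0 ∷ a1 ∷ a0 ∷ []) ∷
  (a3 ∷ a0 ∷ a2 ∷ []) ∷
  (a3 ∷ a0 ∷ a2 ∷ a0 ∷ []) ∷
  (a3 ∷ a0 ∷ a3 ∷ []) ∷
  (a3 ∷ a0 ∷ a3 ∷ a1 ∷ []) ∷
  (a3 ∷ a1 ∷ []) ∷
  (a3 ∷ a1 ∷ a0 ∷ []) ∷
  (a3 ∷ a1 ∷ a0 ∷ a2 ∷ []) ∷
  []

checked : ∀ {b} → b ≡ true → T b
checked = Equivalence.from T-≡

φh : Σ₄ → List (List Σ₄)
φh a = h₁ a ∷ []

open Substitution using (Image; []; _∷_; images)

h-uniform : ∀ {a X} → X ∈ φh a → length X ≡ 10
h-uniform {a0} (here refl) = refl
h-uniform {a1} (here refl) = refl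
h-uniform {a2} (here refl) = refl
h-uniform {a3} (here refl) = refl

h-Image : ∀ W → Image φh (map h₁ W) W
h-Image []      = []
h-Image (a ∷ W) = here refl ∷ h-Image W

module H = Substitution.Uniform φh 10 h-uniform
module H-letters = Distinguishing sameLetterᵇ sameLetterᵇ-refl φh 10 h-uniform
module H-desub = H.Desubstitution 6 5 (m≤m+n 6 4) (m≤m+n 6 0)
  (H-letters.prefix-determines 6 (m≤m+n 6 4) (checked refl)) (H-letters.suffix-determines 5 (m≤m+n 5 5) (checked refl))

h-decoder : List Σ₄ → ℕ
h-decoder = Tries.decoder sameLetterᵇ (phaseTable φh 10 12 Fac)

h-certificate : H.Checks.certifiedᵇ sameLetterᵇ sameLetterᵇ-refl 1 12 0 h-decoder Fac ≡ true
h-certificate = refl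

Fac-closed : T (H.everyWindowᵇ (λ _ t → isYes (take 4 t ∈? Fac)) Fac)
Fac-closed = checked refl

h-preserves : ∀ W → SquareFree W → WindowsIn 4 Fac W → SquareFree (h W) × WindowsIn 4 Fac (h W)
h-preserves W square-free windows = L.no-square square-free , windows′
  where
  module L = H-desub.Certified (h-Image W) sameLetterᵇ sameLetterᵇ-refl 4 1 12 0 Fac h-decoder h-certificate
               (s≤s z≤n) (m≤m+n 34 6) (m≤m+n 10 30) windows
  module HW = H.Windows 4 Fac (h-Image W) windows
  windows′ : WindowsIn 4 Fac (h W)
  windows′ a = subst (_∈ Fac) (take-‼ 4 (HW.window a) (drop a (h W)) λ x x<4 → trans (HW.window-‼ a (fits x<4)) (sym (‼-drop a (h W) x)))
                 (toWitness (HW.window-satisfies (λ _ t → isYes (take 4 t ∈? Fac)) Fac-closed a))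
    where
    fits : ∀ {x} → x < 4 → a % 10 + x < 40
    fits x<4 = +-mono-≤ (m%n<n a 10) (≤-trans (<⇒≤ x<4) (m≤m+n 4 26))

a0-squareFree : SquareFree (a0 ∷ [])
a0-squareFree b (suc q) _ fits _ = 1+n≰n (≤-trans (+-mono-≤ (s≤s z≤n) (s≤s z≤n)) (≤-trans (m≤n+m (suc q + suc q) b) fits))

a0-windows : WindowsIn 4 Fac (a0 ∷ [])
a0-windows zero    = there (here refl)
a0-windows (suc j) = subst (λ w → take 4 w ∈ Fac) (sym (drop-[] j)) (here refl)

h^-properties : ∀ m → SquareFree (h^ m (a0 ∷ [])) × WindowsIn 4 Fac (h^ m (a0 ∷ [])) × length (h^ m (a0 ∷ [])) ≡ 10 ^ m
h^-properties zero    = a0-squareFree , a0-windows , refl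
h^-properties (suc m) = proj₁ next , proj₂ next , trans (H.length-concat (h-Image W)) (cong (10 *_) (proj₂ (proj₂ previous)))
  where
  W = h^ m (a0 ∷ [])
  previous = h^-properties m
  next = h-preserves W (proj₁ previous) (proj₁ (proj₂ previous))

ψ : Σ₄ → List (List Bit)
ψ a = map g (h'₁ a)

ψ-uniform : ∀ {a X} → X ∈ ψ a → length X ≡ 60
ψ-uniform {a0} (here refl)         = refl
ψ-uniform {a1} (here refl)         = refl
ψ-uniform {a1} (there (here refl)) = refl
ψ-uniform {a2} (here refl)         = refl
ψ-uniform {a3} (here refl)         = refl

ψ-unique : ∀ a → Unique (ψ a)
ψ-unique a0 = [] ∷ []
ψ-unique a1 = ((λ ()) ∷ []) ∷ [] ∷ []
ψ-unique a2 = [] ∷ []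
ψ-unique a3 = [] ∷ []

g-++ : ∀ xs ys → g (xs ++ ys) ≡ g xs ++ g ys
g-++ xs ys = trans (cong concat (map-++ g₁ xs ys)) (sym (concat-++ (map g₁ xs) (map g₁ ys)))

∈h'⇒Image : ∀ {v W} → v ∈h' W → ∃[ Bs ] Image ψ Bs W × concat Bs ≡ g v
∈h'⇒Image [] = [] , [] , refl
∈h'⇒Image (_∷_ {u = X} {v = v} X∈ v∈) with ∈h'⇒Image v∈
... | Bs , image , Bs≡ = g X ∷ Bs , ∈-map⁺ g X∈ ∷ image , trans (cong (g X ++_) Bs≡) (sym (g-++ X v))

Image⇒∈h' : ∀ {Bs W} → Image ψ Bs W → ∃[ v ] v ∈h' W × g v ≡ concat Bs
Image⇒∈h' [] = [] , [] , refl
Image⇒∈h' (X∈ ∷ image) with ∈-map⁻ g X∈ | Image⇒∈h' image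
... | Y , Y∈ , refl | v , v∈ , v≡ = Y ++ v , Y∈ ∷ v∈ , trans (g-++ Y v) (cong (g Y ++_) v≡)

module G = Substitution.Uniform ψ 60 ψ-uniform
module G-letters = Distinguishing sameBitᵇ sameBitᵇ-refl ψ 60 ψ-uniform
module G-desub = G.Desubstitution 33 33 (m≤m+n 33 27) (n≤1+n 33)
  (G-letters.prefix-determines 33 (m≤m+n 33 27) (checked refl)) (G-letters.suffix-determines 33 (m≤m+n 33 27) (checked refl))

g-decoder : List Bit → ℕ
g-decoder = Tries.decoder sameBitᵇ (phaseTable ψ 60 83 Fac)

g-certificate : G.Checks.certifiedᵇ sameBitᵇ sameBitᵇ-refl 4 83 3 g-decoder Fac ≡ true
g-certificate = refl

ψ-image-properties : ∀ {Bs W} → SquareFree W → WindowsIn 4 Fac W → Image ψ Bs W →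
                     Cubefree (concat Bs) × NoLongSquare (concat Bs)
ψ-image-properties {Bs} square-free windows image =
  Cubefree-if-aperiodic no-cube , NoLongSquare-if-aperiodic (L.no-square square-free)
  where
  module L = G-desub.Certified image sameBitᵇ sameBitᵇ-refl 4 4 83 3 Fac g-decoder g-certificate
               (s≤s z≤n) (m≤m+n 226 14) (m≤m+n 69 171) windows
  no-cube : ∀ a p → 1 ≤ p → a + (p + p + p) ≤ length (concat Bs) → ¬ Periodic (concat Bs) a p (p + p)
  no-cube a p 1≤p fits with p ≤? 3
  ... | yes p≤3 = L.no-short-cube a p 1≤p p≤3 fits
  ... | no p≰3  = L.no-square square-free a p (≰⇒> p≰3) (≤-trans (+-monoʳ-≤ a (m≤m+n (p + p) p)) fits)
                    ∘ Periodic-shorten (concat Bs) (m≤n+m p p)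

gh'-enumeration : ∀ W → ∃[ L ] Unique L × (∀ u → (u ∈ L) ⇔ (u ∈gh' W)) × length L ≡ product (map (length ∘ h'₁) W)
gh'-enumeration W = map concat (images ψ W) , unique , (λ u → mk⇔ (sound u) complete) , count
  where
  open Substitution ψ using (Image⇒∈images; ∈images⇒Image; images-unique; length-images)
  unique : Unique (map concat (images ψ W))
  unique = Unique-map-on concat (λ Bs → Image ψ Bs W) (tabulate (∈images⇒Image W)) G.concat-injective (images-unique ψ-unique W)
  sound : ∀ u → u ∈ map concat (images ψ W) → u ∈gh' W
  sound u u∈ with ∈-map⁻ concat u∈
  ... | Bs , Bs∈ , refl with Image⇒∈h' (∈images⇒Image W Bs∈)
  ...   | v , v∈ , v≡ = v , v∈ , v≡
  complete : ∀ {u} → u ∈gh' W → u ∈ map concat (images ψ W)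
  complete (v , v∈ , refl) with ∈h'⇒Image v∈
  ... | Bs , image , Bs≡ = subst (_∈ map concat (images ψ W)) Bs≡ (∈-map⁺ concat (Image⇒∈images image))
  count : length (map concat (images ψ W)) ≡ product (map (length ∘ h'₁) W)
  count = trans (length-map concat (images ψ W)) (trans (length-images W) (cong product (map-cong (λ a → length-map g (h'₁ a)) W)))

choices-in-h : ∀ W → product (map (length ∘ h'₁) (h W)) ≡ 4 ^ length W
choices-in-h []      = refl
choices-in-h (a ∷ W) = begin
  product (map ℓ (h₁ a ++ h W))                  ≡⟨ cong product (map-++ ℓ (h₁ a) (h W)) ⟩
  product (map ℓ (h₁ a) ++ map ℓ (h W))          ≡⟨ product-++ (map ℓ (h₁ a)) (map ℓ (h W)) ⟩
  product (map ℓ (h₁ a)) * product (map ℓ (h W)) ≡⟨ cong₂ _*_ (choices-in-block a) (choices-in-h W) ⟩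
  4 * 4 ^ length W                               ∎
  where
  open ≡-Reasoning
  ℓ = length ∘ h'₁
  choices-in-block : ∀ a → product (map ℓ (h₁ a)) ≡ 4
  choices-in-block a0 = refl
  choices-in-block a1 = refl
  choices-in-block a2 = refl
  choices-in-block a3 = refl

gh'-properties : ∀ m u → u ∈gh' h^ m (a0 ∷ []) → length u ≡ 60 * 10 ^ m × Cubefree u × NoLongSquare u
gh'-properties m u (v , v∈ , refl) = subst P Bs≡ (length-Bs , ψ-image-properties square-free windows image)
  where
  P : List Bit → Set
  P w = length w ≡ 60 * 10 ^ m × Cubefree w × NoLongSquare w
  W-properties = h^-properties m
  square-free = proj₁ W-properties
  windows = proj₁ (proj₂ W-properties)
  decomposition = ∈h'⇒Image v∈
  Bs = proj₁ decomposition
  image = proj₁ (proj₂ decomposition)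
  Bs≡ = proj₂ (proj₂ decomposition)
  length-Bs : length (concat Bs) ≡ 60 * 10 ^ m
  length-Bs = trans (G.length-concat image) (cong (60 *_) (proj₂ (proj₂ W-properties)))

exponent : ∀ m → (60 * 10 ^ suc m) / 300 ≡ 2 * 10 ^ m
exponent m = trans (cong (_/ 300) (rearrange (10 ^ m))) (m*n/n≡m (2 * 10 ^ m) 300)
  where
  rearrange : ∀ x → 60 * (10 * x) ≡ 2 * x * 300
  rearrange = solve-∀

lemma7 : (m : ℕ) → 1 ≤ m →
    (∃[ L ] (Unique L × (∀ u → (u ∈ L) ⇔ (u ∈gh' h^ m (a0 ∷ []))) × length L ≡ 2 ^ ((60 * 10 ^ m) / 300)))
    × (∀ u → u ∈gh' h^ m (a0 ∷ []) → length u ≡ 60 * 10 ^ m × Cubefree u × NoLongSquare u)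
lemma7 (suc m) _ = (L , unique , membership , count) , gh'-properties (suc m)
  where
  W = h^ m (a0 ∷ [])
  enumeration = gh'-enumeration (h W)
  L = proj₁ enumeration
  unique = proj₁ (proj₂ enumeration)
  membership = proj₁ (proj₂ (proj₂ enumeration))
  count : length L ≡ 2 ^ ((60 * 10 ^ suc m) / 300)
  count = begin
    length L                        ≡⟨ proj₂ (proj₂ (proj₂ enumeration)) ⟩
    product (map (length ∘ h'₁) (h W)) ≡⟨ choices-in-h W ⟩
    4 ^ length W                    ≡⟨ cong (4 ^_) (proj₂ (proj₂ (h^-properties m))) ⟩
    (2 ^ 2) ^ (10 ^ m)              ≡⟨ ^-*-assoc 2 2 (10 ^ m) ⟩
    2 ^ (2 * 10 ^ m)                ≡⟨ cong (2 ^_) (sym (exponent m)) ⟩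
    2 ^ ((60 * 10 ^ suc m) / 300)   ∎
    where open ≡-Reasoning
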